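{- Let $G$ be a trapezoid graph, given by a trapezoid diagram with $n$ trapezoids as in the context, and suppose $G$ is not the complete graph $K_n$. Then the vertex connectivity of $G$ satisfies $$\kappa(G)=\min_{1\le x\le 2n,\ 1\le y\le 2n} N(x,y).$$
   Context: A trapezoid diagram consists of two horizontal parallel lines (upper and lower) and $n$ trapezoids $T[1],\dots,T[n]$, where $T[i]$ has upper corners $a[i]<b[i]$ on the upper line and lower corners $c[i]<d[i]$ on the lower line; the $2n$ upper corner points are exactly the integers $1,\dots,2n$ (all distinct), and likewise the $2n$ lower corner points are exactly $1,\dots,2n$. The trapezoid graph $G$ has vertex set $\{1,\dots,n\}$, with $i\ne j$ adjacent iff $T[i]$ and $T[j]$ intersect, i.e. iff neither ($b[i]<a[j]$ and $d[i]<c[j]$) nor ($b[j]<a[i]$ and $d[j]<c[i]$) holds. The vertex connectivity $\kappa(G)$ of a non-complete graph is the minimum size of a vertex set whose removal disconnects the graph. For integers $x,y$, a cut line $p$ is a straight line segment joining a point of the open interval $(x,x+1)$ on the upper line to a point of the open interval $(y,y+1)$ on the lower line. A trapezoid $T[i]$ lies completely to the left of $p$ if $b[i]\le x$ and $d[i]\le y$, completely to the right of $p$ if $a[i]\ge x+1$ and $c[i]\ge y+1$, and otherwise it has common points with $p$. Define $N(x,y)$ to be the number of trapezoids having common points with $p$, except that $N(x,y)=\infty$ if there is no trapezoid completely to the left of $p$ or no trapezoid completely to the right of $p$. -}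

module Defs where

open import Data.Nat using (ℕ; suc; _+_; _*_; _≤_; _<_; _≤ᵇ_)
open import Data.Bool using (Bool; true; false; _∧_; not)
open import Data.Fin using (Fin)
open import Data.Fin.Subset using (Subset; _∈_; _∉_; ∣_∣)
open import Data.Vec using (tabulate)
open import Data.List using (allFin)
open import Data.Bool.ListAction using (any)
open import Data.Maybe using (Maybe; just; nothing)
open import Data.Sum using (_⊎_; inj₁; inj₂; [_,_])
open import Data.Product using (Σ; _×_; ∃; ∃-syntax)
open import Relation.Binary.PropositionalEquality using (_≡_; _≢_)
open import Relation.Nullary using (¬_)
open import Function.Definitions using (Injective)

record TrapezoidDiagram (n : ℕ) : Set where
  field
    a b c d : Fin n → ℕ
    a<b : ∀ i → a i < b i
    c<d : ∀ i → c i < d i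
  upper : Fin n ⊎ Fin n → ℕ
  upper = [ a , b ]
  lower : Fin n ⊎ Fin n → ℕ
  lower = [ c , d ]
  field
    upper-injective : Injective _≡_ _≡_ upper
    upper-range     : ∀ p → 1 ≤ upper p × upper p ≤ 2 * n
    upper-onto      : ∀ k → 1 ≤ k → k ≤ 2 * n → ∃[ p ] upper p ≡ k
    lower-injective : Injective _≡_ _≡_ lower
    lower-range     : ∀ p → 1 ≤ lower p × lower p ≤ 2 * n
    lower-onto      : ∀ k → 1 ≤ k → k ≤ 2 * n → ∃[ p ] lower p ≡ k

module _ {n : ℕ} (D : TrapezoidDiagram n) where
  open TrapezoidDiagram D

  LeftOf : Fin n → Fin n → Set
  LeftOf i j = b i < a j × d i < c j

  Adj : Fin n → Fin n → Set
  Adj i j = i ≢ j × ¬ LeftOf i j × ¬ LeftOf j i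

  NotComplete : Set
  NotComplete = ∃[ i ] ∃[ j ] (i ≢ j × ¬ Adj i j)

  -- u reaches v in G - S (a path all of whose vertices after u avoid S)
  data Reach (S : Subset n) : Fin n → Fin n → Set where
    here : ∀ {u} → Reach S u u
    step : ∀ {u w v} → Adj u w → w ∉ S → Reach S w v → Reach S u v

  Disconnects : Subset n → Set
  Disconnects S = ∃[ u ] ∃[ v ] (u ∉ S × v ∉ S × ¬ Reach S u v)

  IsVertexConnectivity : ℕ → Set
  IsVertexConnectivity k =
    (∃[ S ] (Disconnects S × ∣ S ∣ ≡ k)) × (∀ S → Disconnects S → k ≤ ∣ S ∣)

  -- cut line through (x,x+1) on upper line, (y,y+1) on lower line
  leftᵇ : ℕ → ℕ → Fin n → Bool
  leftᵇ x y i = (b i ≤ᵇ x) ∧ (d i ≤ᵇ y)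

  rightᵇ : ℕ → ℕ → Fin n → Bool
  rightᵇ x y i = (suc x ≤ᵇ a i) ∧ (suc y ≤ᵇ c i)

  crossing : ℕ → ℕ → Subset n
  crossing x y = tabulate (λ i → not (leftᵇ x y i) ∧ not (rightᵇ x y i))

  -- N(x,y), with nothing representing ∞
  N : ℕ → ℕ → Maybe ℕ
  N x y with any (leftᵇ x y) (allFin n) ∧ any (rightᵇ x y) (allFin n)
  ... | true  = just ∣ crossing x y ∣
  ... | false = nothing

  IsMinN : ℕ → Set
  IsMinN k =
    (∃[ x ] ∃[ y ] (1 ≤ x × x ≤ 2 * n × 1 ≤ y × y ≤ 2 * n × N x y ≡ just k))
    × (∀ x y m → 1 ≤ x → x ≤ 2 * n → 1 ≤ y → y ≤ 2 * n → N x y ≡ just m → k ≤ m)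

-- A cut line with trapezoids completely on both sides separates them once the
-- trapezoids meeting it are removed, since an edge between two trapezoids on
-- opposite sides is impossible; this gives κ(G) ≤ min N.
-- Conversely, let S separate u from v, with T[u] completely left of T[v].
-- Start with the cut line through the right corners of T[u] and sweep it to
-- the right: while some trapezoid outside S meets the line, move the line
-- past that trapezoid's right corners. Every trapezoid outside S that is
-- passed over is reachable from u in G − S, so v is never passed over, and
-- when the sweep stops, every trapezoid meeting the line lies in S. Hence
-- min N ≤ |S|.
module Submission where

open import Defs
open import Data.Bool using (Bool; true; T)
open import Data.Bool.ListAction using (any)
open import Data.Bool.Properties using (T-≡)
open import Data.Empty using (⊥-elim)
open import Data.Fin using (Fin)
open import Data.Fin.Properties using (any?)
open import Data.Fin.Subset using (Subset; _∈_; _∉_; ∣_∣; _⊆_)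
open import Data.Fin.Subset.Properties using (p⊆q⇒∣p∣≤∣q∣; _∈?_)
open import Data.List using (allFin)
open import Data.List.Membership.Propositional as List using (lose)
open import Data.List.Membership.Propositional.Properties using (∈-allFin)
open import Data.List.Relation.Unary.Any using (satisfied)
open import Data.List.Relation.Unary.Any.Properties using (any⁺; any⁻)
open import Data.Maybe using (just)
open import Data.Maybe.Properties using (≡-dec)
open import Data.Nat using (ℕ; zero; suc; _*_; _+_; _∸_; _⊔_; _≤_; _<_; z≤n; s≤s; _≤?_; _≟_)
open import Data.Nat.Induction using (<-wellFounded)
open import Data.Nat.Properties
open import Data.Product using (Σ; _×_; ∃; ∃-syntax; _,_; proj₁; proj₂)
open import Data.Sum using (_⊎_; inj₁; inj₂)
open import Data.Unit using (tt)
open import Data.Vec using (tabulate)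
open import Data.Vec.Properties using (lookup∘tabulate; []=⇒lookup; lookup⇒[]=)
open import Function.Bundles using (_⇔_; mk⇔; Equivalence)
open import Function.Construct.Composition using (_⇔-∘_)
open import Induction.WellFounded using (Acc; acc)
open import Relation.Binary.PropositionalEquality using (_≡_; _≢_; refl; sym; trans)
open import Relation.Nullary using (¬_; Dec; yes; no)
open import Relation.Nullary.Decidable using (map′; _×-dec_; ¬?)
open import Relation.Nullary.Reflects using (Reflects; ofʸ; ofⁿ; _×-reflects_; ¬-reflects)

Reflects⇒T⇔ : ∀ {a} {A : Set a} {b} → Reflects A b → T b ⇔ A
Reflects⇒T⇔ (ofʸ a)  = mk⇔ (λ _ → a) (λ _ → tt)
Reflects⇒T⇔ (ofⁿ ¬a) = mk⇔ (λ ()) ¬a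

T-any⇒∃ : ∀ {a p} {A : Set a} {P : A → Set p} {f : A → Bool} →
          (∀ x → Reflects (P x) (f x)) → ∀ xs → T (any f xs) → ∃ P
T-any⇒∃ reflects xs t with satisfied (any⁻ _ xs t)
... | x , fx = x , Equivalence.to (Reflects⇒T⇔ (reflects x)) fx

member⇒any≡true : ∀ {a p} {A : Set a} {P : A → Set p} {f : A → Bool} →
                  (∀ x → Reflects (P x) (f x)) → ∀ {x xs} → x List.∈ xs → P x → any f xs ≡ true
member⇒any≡true reflects {x} x∈xs px =
  Equivalence.to T-≡ (any⁺ _ (lose x∈xs (Equivalence.from (Reflects⇒T⇔ (reflects x)) px)))

∈-tabulate⇔T : ∀ {m} (f : Fin m → Bool) i → i ∈ tabulate f ⇔ T (f i)
∈-tabulate⇔T f i = mk⇔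
  (λ i∈ → Equivalence.from T-≡ (trans (sym (lookup∘tabulate f i)) ([]=⇒lookup i∈)))
  (λ fi → lookup⇒[]= i _ (trans (lookup∘tabulate f i) (Equivalence.to T-≡ fi)))

anyInRange? : ∀ {p} {P : ℕ → Set p} → (∀ x → Dec (P x)) →
              ∀ B → Dec (∃[ x ] (1 ≤ x × x ≤ B × P x))
anyInRange? {P = P} P? B = map′ to from (anyUpTo? (λ x → (1 ≤? x) ×-dec P? x) (suc B))
  where
  to : ∃[ x ] (x < suc B × 1 ≤ x × P x) → ∃[ x ] (1 ≤ x × x ≤ B × P x)
  to (x , s≤s x≤B , 1≤x , px) = x , 1≤x , x≤B , px
  from : ∃[ x ] (1 ≤ x × x ≤ B × P x) → ∃[ x ] (x < suc B × 1 ≤ x × P x)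
  from (x , 1≤x , x≤B , px) = x , s≤s x≤B , 1≤x , px

least-satisfying : ∀ {p} {P : ℕ → Set p} → (∀ m → Dec (P m)) →
                   ∀ {m} → P m → ∃[ k ] (P k × (∀ m → P m → k ≤ m))
least-satisfying P? {zero} p0 = zero , p0 , λ _ _ → z≤n
least-satisfying P? {suc m} pm with P? zero
... | yes p0 = zero , p0 , λ _ _ → z≤n
... | no ¬p0 with least-satisfying (λ m → P? (suc m)) pm
...   | k , pk , k-least = suc k , pk , suc-least
  where
  suc-least : ∀ m → _ → suc k ≤ m
  suc-least zero    p0 = ⊥-elim (¬p0 p0)
  suc-least (suc m) pm = s≤s (k-least m pm)

slack : ℕ → ℕ → ℕ → ℕ
slack B x y = (B ∸ x) + (B ∸ y)

slack-⊔-< : ∀ {B x y p q} → x ≤ B → y ≤ B → p ≤ B → q ≤ B → ¬ (p ≤ x × q ≤ y) →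
            slack B (x ⊔ p) (y ⊔ q) < slack B x y
slack-⊔-< {B} {x} {y} {p} {q} x≤B y≤B p≤B q≤B ¬p≤x×q≤y with p ≤? x | q ≤? y
... | yes p≤x | yes q≤y = ⊥-elim (¬p≤x×q≤y (p≤x , q≤y))
... | no p≰x  | _       =
  +-mono-<-≤ (∸-monoʳ-< (<-≤-trans (≰⇒> p≰x) (m≤n⊔m x p)) (⊔-lub x≤B p≤B))
             (∸-monoʳ-≤ B (m≤m⊔n y q))
... | yes _   | no q≰y  =
  +-mono-≤-< (∸-monoʳ-≤ B (m≤m⊔n x p))
             (∸-monoʳ-< (<-≤-trans (≰⇒> q≰y) (m≤n⊔m y q)) (⊔-lub y≤B q≤B))

module _ {n : ℕ} (D : TrapezoidDiagram n) where
  open TrapezoidDiagram D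

  LeftOfCut : ℕ → ℕ → Fin n → Set
  LeftOfCut x y i = b i ≤ x × d i ≤ y

  RightOfCut : ℕ → ℕ → Fin n → Set
  RightOfCut x y i = x < a i × y < c i

  leftᵇ-reflects : ∀ x y i → Reflects (LeftOfCut x y i) (leftᵇ D x y i)
  leftᵇ-reflects x y i = ≤ᵇ-reflects-≤ (b i) x ×-reflects ≤ᵇ-reflects-≤ (d i) y

  rightᵇ-reflects : ∀ x y i → Reflects (RightOfCut x y i) (rightᵇ D x y i)
  rightᵇ-reflects x y i = ≤ᵇ-reflects-≤ (suc x) (a i) ×-reflects ≤ᵇ-reflects-≤ (suc y) (c i)

  ∈-crossing⇔ : ∀ {x y i} → i ∈ crossing D x y ⇔ (¬ LeftOfCut x y i × ¬ RightOfCut x y i)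
  ∈-crossing⇔ {x} {y} {i} =
    Reflects⇒T⇔ (¬-reflects (leftᵇ-reflects x y i) ×-reflects ¬-reflects (rightᵇ-reflects x y i))
    ⇔-∘ ∈-tabulate⇔T _ i

  ∉-crossing⇒LeftOfCut⊎RightOfCut : ∀ {x y i} → i ∉ crossing D x y →
                                     LeftOfCut x y i ⊎ RightOfCut x y i
  ∉-crossing⇒LeftOfCut⊎RightOfCut {x} {y} {i} i∉
    with (b i ≤? x) ×-dec (d i ≤? y) | (suc x ≤? a i) ×-dec (suc y ≤? c i)
  ... | yes left | _         = inj₁ left
  ... | no _     | yes right = inj₂ right
  ... | no ¬left | no ¬right = ⊥-elim (i∉ (Equivalence.from ∈-crossing⇔ (¬left , ¬right)))

  LeftOfCut⇒¬RightOfCut : ∀ {x y i} → LeftOfCut x y i → ¬ RightOfCut x y i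
  LeftOfCut⇒¬RightOfCut {i = i} (bi≤x , _) (x<ai , _) =
    <-irrefl refl (≤-trans (<-trans x<ai (a<b i)) bi≤x)

  LeftOfCut∧RightOfCut⇒LeftOf : ∀ {x y i j} → LeftOfCut x y i → RightOfCut x y j → LeftOf D i j
  LeftOfCut∧RightOfCut⇒LeftOf (bi≤x , di≤y) (x<aj , y<cj) = ≤-<-trans bi≤x x<aj , ≤-<-trans di≤y y<cj

  N≡just : ∀ {x y u v} → LeftOfCut x y u → RightOfCut x y v → N D x y ≡ just ∣ crossing D x y ∣
  N≡just {x} {y} {u} {v} left right
    rewrite member⇒any≡true (leftᵇ-reflects x y) (∈-allFin u) left
          | member⇒any≡true (rightᵇ-reflects x y) (∈-allFin v) right = refl

  N≡just⇒T : ∀ {x y m} → N D x y ≡ just m →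
             T (any (leftᵇ D x y) (allFin n)) × T (any (rightᵇ D x y) (allFin n)) × ∣ crossing D x y ∣ ≡ m
  N≡just⇒T {x} {y} eq with any (leftᵇ D x y) (allFin n) | any (rightᵇ D x y) (allFin n)
  N≡just⇒T refl | true | true = tt , tt , refl

  N≡just⁻¹ : ∀ {x y m} → N D x y ≡ just m →
             ∃ (LeftOfCut x y) × ∃ (RightOfCut x y) × ∣ crossing D x y ∣ ≡ m
  N≡just⁻¹ {x} {y} eq with N≡just⇒T eq
  ... | some-left , some-right , size =
    T-any⇒∃ (leftᵇ-reflects x y) (allFin n) some-left ,
    T-any⇒∃ (rightᵇ-reflects x y) (allFin n) some-right , size

  Adj-sym : ∀ {u v} → Adj D u v → Adj D v u
  Adj-sym (u≢v , ¬uv , ¬vu) = (λ v≡u → u≢v (sym v≡u)) , ¬vu , ¬uv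

  nonadjacent⇒ordered : ∀ {u v} → u ≢ v → ¬ Adj D u v → LeftOf D u v ⊎ LeftOf D v u
  nonadjacent⇒ordered {u} {v} u≢v ¬adj
    with (suc (b u) ≤? a v) ×-dec (suc (d u) ≤? c v) | (suc (b v) ≤? a u) ×-dec (suc (d v) ≤? c u)
  ... | yes uv | _      = inj₁ uv
  ... | no _   | yes vu = inj₂ vu
  ... | no ¬uv | no ¬vu = ⊥-elim (¬adj (u≢v , ¬uv , ¬vu))

  Reach-snoc : ∀ {S u w v} → Reach D S u w → Adj D w v → v ∉ S → Reach D S u v
  Reach-snoc here             adj v∉S = step adj v∉S here
  Reach-snoc (step a₁ w∉S r) adj v∉S = step a₁ w∉S (Reach-snoc r adj v∉S)

  Reach-sym : ∀ {S u v} → u ∉ S → Reach D S u v → Reach D S v u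
  Reach-sym u∉S here             = here
  Reach-sym u∉S (step adj w∉S r) = Reach-snoc (Reach-sym w∉S r) (Adj-sym adj) u∉S

  crossing-separates : ∀ {x y u v} → LeftOfCut x y u → RightOfCut x y v →
                       ¬ Reach D (crossing D x y) u v
  crossing-separates left right here = LeftOfCut⇒¬RightOfCut left right
  crossing-separates left right (step (_ , ¬uw , _) w∉ r) with ∉-crossing⇒LeftOfCut⊎RightOfCut w∉
  ... | inj₁ left-w  = crossing-separates left-w right r
  ... | inj₂ right-w = ¬uw (LeftOfCut∧RightOfCut⇒LeftOf left right-w)

  N≡just⇒crossing-disconnects : ∀ {x y m} → N D x y ≡ just m →
                                Disconnects D (crossing D x y) × ∣ crossing D x y ∣ ≡ m
  N≡just⇒crossing-disconnects eq with N≡just⁻¹ eq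
  ... | (u , left) , (v , right) , size =
    (u , v , (λ u∈ → proj₁ (Equivalence.to ∈-crossing⇔ u∈) left)
           , (λ v∈ → proj₂ (Equivalence.to ∈-crossing⇔ v∈) right)
           , crossing-separates left right) , size

  crosses-corner-cut⇒Adj : ∀ {u w} → ¬ LeftOfCut (b u) (d u) w → ¬ RightOfCut (b u) (d u) w →
                           Adj D u w
  crosses-corner-cut⇒Adj {u} ¬left ¬right =
    (λ { refl → ¬left (≤-refl , ≤-refl) }) , ¬right ,
    λ (bw<au , dw<cu) → ¬left (<⇒≤ (<-trans bw<au (a<b u)) , <⇒≤ (<-trans dw<cu (c<d u)))

  passed-over⇒Adj : ∀ {x y w₀ w} → ¬ RightOfCut x y w₀ → RightOfCut x y w →
                    ¬ RightOfCut (x ⊔ b w₀) (y ⊔ d w₀) w → Adj D w₀ w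
  passed-over⇒Adj {w = w} ¬right₀ right@(x<aw , y<cw) ¬right′ =
    (λ { refl → ¬right₀ right }) ,
    (λ (bw₀<aw , dw₀<cw) → ¬right′ (⊔-lub x<aw bw₀<aw , ⊔-lub y<cw dw₀<cw)) ,
    λ (bw<aw₀ , dw<cw₀) → ¬right₀ (<-trans x<aw (<-trans (a<b w) bw<aw₀) ,
                                   <-trans y<cw (<-trans (c<d w) dw<cw₀))

  b≥1 : ∀ i → 1 ≤ b i
  b≥1 i = proj₁ (upper-range (inj₂ i))

  b≤2n : ∀ i → b i ≤ 2 * n
  b≤2n i = proj₂ (upper-range (inj₂ i))

  d≥1 : ∀ i → 1 ≤ d i
  d≥1 i = proj₁ (lower-range (inj₂ i))

  d≤2n : ∀ i → d i ≤ 2 * n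
  d≤2n i = proj₂ (lower-range (inj₂ i))

  module Sweep (S : Subset n) (u : Fin n) where

    record SweptCut : Set where
      field
        x y    : ℕ
        bu≤x   : b u ≤ x
        du≤y   : d u ≤ y
        x≤2n   : x ≤ 2 * n
        y≤2n   : y ≤ 2 * n
        swept  : ∀ {w} → w ∉ S → ¬ RightOfCut x y w → ¬ LeftOfCut (b u) (d u) w → Reach D S u w

      remaining : ℕ
      remaining = slack (2 * n) x y

      passed⇒¬LeftOfCorner : ∀ {w} → ¬ LeftOfCut x y w → ¬ LeftOfCut (b u) (d u) w
      passed⇒¬LeftOfCorner ¬left (bw≤bu , dw≤du) = ¬left (≤-trans bw≤bu bu≤x , ≤-trans dw≤du du≤y)

    open SweptCut

    start : SweptCut
    start = record
      { x = b u ; y = d u ; bu≤x = ≤-refl ; du≤y = ≤-refl ; x≤2n = b≤2n u ; y≤2n = d≤2n u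
      ; swept = λ w∉S ¬right ¬left → step (crosses-corner-cut⇒Adj ¬left ¬right) w∉S here }

    advance : ∀ (C : SweptCut) {w₀} → w₀ ∉ S → w₀ ∈ crossing D (x C) (y C) →
              Σ SweptCut (λ C′ → remaining C′ < remaining C)
    advance C {w₀} w₀∉S w₀∈ = C′ , slack-⊔-< (x≤2n C) (y≤2n C) (b≤2n w₀) (d≤2n w₀) ¬left₀
      where
      ¬left₀ : ¬ LeftOfCut (x C) (y C) w₀
      ¬left₀ = proj₁ (Equivalence.to ∈-crossing⇔ w₀∈)
      ¬right₀ : ¬ RightOfCut (x C) (y C) w₀
      ¬right₀ = proj₂ (Equivalence.to ∈-crossing⇔ w₀∈)
      reach₀ : Reach D S u w₀
      reach₀ = swept C w₀∉S ¬right₀ (passed⇒¬LeftOfCorner C ¬left₀)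
      swept′ : ∀ {w} → w ∉ S → ¬ RightOfCut (x C ⊔ b w₀) (y C ⊔ d w₀) w →
               ¬ LeftOfCut (b u) (d u) w → Reach D S u w
      swept′ {w} w∉S ¬right′ ¬left with (suc (x C) ≤? a w) ×-dec (suc (y C) ≤? c w)
      ... | no ¬right  = swept C w∉S ¬right ¬left
      ... | yes right = Reach-snoc reach₀ (passed-over⇒Adj ¬right₀ right ¬right′) w∉S
      C′ : SweptCut
      C′ = record
        { x = x C ⊔ b w₀ ; y = y C ⊔ d w₀
        ; bu≤x = ≤-trans (bu≤x C) (m≤m⊔n _ _) ; du≤y = ≤-trans (du≤y C) (m≤m⊔n _ _)
        ; x≤2n = ⊔-lub (x≤2n C) (b≤2n w₀) ; y≤2n = ⊔-lub (y≤2n C) (d≤2n w₀)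
        ; swept = swept′ }

    sweep : ∀ (C : SweptCut) → Acc _<_ (remaining C) →
            Σ SweptCut (λ C′ → ∀ {w} → w ∉ S → w ∉ crossing D (x C′) (y C′))
    sweep C (acc smaller) with any? (λ w → ¬? (w ∈? S) ×-dec (w ∈? crossing D (x C) (y C)))
    ... | no none = C , λ w∉S w∈ → none (_ , w∉S , w∈)
    ... | yes (w₀ , w₀∉S , w₀∈) with advance C w₀∉S w₀∈
    ...   | C′ , progress = sweep C′ (smaller progress)

  CutValue : ℕ → Set
  CutValue m = ∃[ x ] ∃[ y ] (1 ≤ x × x ≤ 2 * n × 1 ≤ y × y ≤ 2 * n × N D x y ≡ just m)

  CutValue? : ∀ m → Dec (CutValue m)
  CutValue? m = map′ to from
    (anyInRange? (λ x → anyInRange? (λ y → ≡-dec _≟_ (N D x y) (just m)) (2 * n)) (2 * n))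
    where
    to : ∃[ x ] (1 ≤ x × x ≤ 2 * n × ∃[ y ] (1 ≤ y × y ≤ 2 * n × N D x y ≡ just m)) → CutValue m
    to (x , 1≤x , x≤ , y , 1≤y , y≤ , eq) = x , y , 1≤x , x≤ , 1≤y , y≤ , eq
    from : CutValue m → ∃[ x ] (1 ≤ x × x ≤ 2 * n × ∃[ y ] (1 ≤ y × y ≤ 2 * n × N D x y ≡ just m))
    from (x , y , 1≤x , x≤ , 1≤y , y≤ , eq) = x , 1≤x , x≤ , y , 1≤y , y≤ , eq

  separated⇒CutValue≤ : ∀ {S u v} → v ∉ S → ¬ Reach D S u v → LeftOf D u v →
                        ∃[ m ] (CutValue m × m ≤ ∣ S ∣)
  separated⇒CutValue≤ {S} {u} {v} v∉S ¬reach u<v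
    with Sweep.sweep S u (Sweep.start S u) (<-wellFounded _)
  ... | C , unblocked =
    _ , (x , y , ≤-trans (b≥1 u) bu≤x , x≤2n , ≤-trans (d≥1 u) du≤y , y≤2n , N≡just (bu≤x , du≤y) right) ,
    p⊆q⇒∣p∣≤∣q∣ crossing⊆S
    where
    open Sweep.SweptCut C
    right : RightOfCut x y v
    right with ∉-crossing⇒LeftOfCut⊎RightOfCut (unblocked v∉S)
    ... | inj₂ right = right
    ... | inj₁ left  = ⊥-elim (¬reach (swept v∉S (LeftOfCut⇒¬RightOfCut left)
                                              (λ left₀ → LeftOfCut⇒¬RightOfCut left₀ u<v)))
    crossing⊆S : crossing D x y ⊆ S
    crossing⊆S {w} w∈ with w ∈? S
    ... | yes w∈S = w∈S
    ... | no  w∉S = ⊥-elim (unblocked w∉S w∈)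

  corner-CutValue : ∀ {i j} → LeftOf D i j → CutValue ∣ crossing D (b i) (d i) ∣
  corner-CutValue {i} i<j = b i , d i , b≥1 i , b≤2n i , d≥1 i , d≤2n i , N≡just (≤-refl , ≤-refl) i<j

  disconnecting⇒CutValue≤ : ∀ {S} → Disconnects D S → ∃[ m ] (CutValue m × m ≤ ∣ S ∣)
  disconnecting⇒CutValue≤ (u , v , u∉S , v∉S , ¬reach)
    with nonadjacent⇒ordered (λ { refl → ¬reach here }) (λ adj → ¬reach (step adj v∉S here))
  ... | inj₁ u<v = separated⇒CutValue≤ v∉S ¬reach u<v
  ... | inj₂ v<u = separated⇒CutValue≤ u∉S (λ r → ¬reach (Reach-sym v∉S r)) v<u

  CutValue⇒connectivity≡minN : ∀ {m} → CutValue m → ∃[ k ] (IsVertexConnectivity D k × IsMinN D k)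
  CutValue⇒connectivity≡minN cut with least-satisfying CutValue? cut
  ... | k , min@(x , y , _ , _ , _ , _ , eq) , k-least =
    k , ((crossing D x y , N≡just⇒crossing-disconnects eq) ,
         λ S disc → let (m , cut-m , m≤S) = disconnecting⇒CutValue≤ disc in ≤-trans (k-least m cut-m) m≤S) ,
        (min , λ x y m 1≤x x≤ 1≤y y≤ eq → k-least m (x , y , 1≤x , x≤ , 1≤y , y≤ , eq))

lemma2 : (n : ℕ) (D : TrapezoidDiagram n) → NotComplete D →
         ∃[ k ] (IsVertexConnectivity D k × IsMinN D k)
lemma2 n D (i , j , i≢j , ¬adj) with nonadjacent⇒ordered D i≢j ¬adj
... | inj₁ i<j = CutValue⇒connectivity≡minN D (corner-CutValue D i<j)
... | inj₂ j<i = CutValue⇒connectivity≡minN D (corner-CutValue D j<i)
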